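{- Let $M=(E,\mathcal L)$ be a nearly finitary matroid, and let $\hat M=(E,\mathcal K)$, where $S\in\mathcal K$ iff there exist a base $F$ of $M^{\mathrm{fin}}$ and a base $B$ of $M$ with $B\subseteq F$ and $S\subseteq F\setminus B$. If $\hat M$ is a matroid, then $M$ is $k$-nearly finitary for some natural number $k$.
   Context: A matroid is a pair $M=(E,\mathcal L)$, where $E$ is a possibly infinite set and $\mathcal L\subseteq 2^E$ satisfies: (I1) $\emptyset\in\mathcal L$; (I2) if $B\in\mathcal L$ and $A\subseteq B$ then $A\in\mathcal L$; (I3) if $B$ is a maximal element of $\mathcal L$ and $A\in\mathcal L$ is not maximal, then there is $b\in B\setminus A$ with $A\cup\{b\}\in\mathcal L$; (I4) if $A\in\mathcal L$ and $A\subseteq X\subseteq E$, then $\{S\in\mathcal L: A\subseteq S\subseteq X\}$ has a maximal element. Maximality is with respect to inclusion, and maximal independent sets are bases. The finitarization is $M^{\mathrm{fin}}=(E,\mathcal L^{\mathrm{fin}})$, where $S\in\mathcal L^{\mathrm{fin}}$ iff every finite subset of $S$ is in $\mathcal L$; this is a matroid. $M$ is nearly finitary if whenever $F$ is a base of $M^{\mathrm{fin}}$, $B$ is a base of $M$ and $B\subseteq F$, the set $F\setminus B$ is finite. For an integer $k$, $M$ is $k$-nearly finitary if in this situation always $|F\setminus B|\le k$. -}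

module Defs where

open import Level using (0ℓ)
open import Data.Nat using (ℕ; _≤_)
open import Data.List using (List; length)
open import Data.List.Membership.Propositional using (_∈_)
open import Data.Product using (Σ; ∃; _×_; _,_)
open import Data.Sum using (_⊎_)
import Data.Empty
open import Relation.Nullary using (¬_)
open import Relation.Unary using (Pred; _⊆_; _∪_; _∩_; ∁; ｛_｝)

-- Classical logic (excluded middle), the ambient logic of the paper.
ExcludedMiddle : Set₂
ExcludedMiddle = (P : Set₁) → P ⊎ ¬ P

-- Subsets of the ground set E (E is a type; the ground set is all of E).
Subset : Set → Set₁
Subset E = Pred E 0ℓ

Family : Set → Set₂
Family E = Subset E → Set₁

module _ {E : Set} where

  _∖_ : Subset E → Subset E → Subset E
  F ∖ B = F ∩ ∁ B

  Maximal : Family E → Subset E → Set₁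
  Maximal P A = P A × (∀ (B : Subset E) → P B → A ⊆ B → B ⊆ A)

  record IsMatroid (𝓛 : Family E) : Set₁ where
    field
      I1 : 𝓛 (λ _ → Data.Empty.⊥)
      I2 : ∀ (A B : Subset E) → 𝓛 B → A ⊆ B → 𝓛 A
      I3 : ∀ (A B : Subset E) → Maximal 𝓛 B → 𝓛 A → ¬ Maximal 𝓛 A →
           Σ E λ b → B b × ¬ A b × 𝓛 (A ∪ ｛ b ｝)
      I4 : ∀ (A X : Subset E) → 𝓛 A → A ⊆ X →
           Σ (Subset E) λ S → Maximal (λ T → 𝓛 T × A ⊆ T × T ⊆ X) S

  Finite : Subset E → Set
  Finite S = Σ (List E) λ xs → S ⊆ (λ x → x ∈ xs)

  AtMost : ℕ → Subset E → Set
  AtMost k S = Σ (List E) λ xs → length xs ≤ k × S ⊆ (λ x → x ∈ xs)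

  Fin[_] : Family E → Family E
  Fin[ 𝓛 ] S = ∀ (T : Subset E) → Finite T → T ⊆ S → 𝓛 T

  Base : Family E → Subset E → Set₁
  Base 𝓛 = Maximal 𝓛

  NearlyFinitary : Family E → Set₁
  NearlyFinitary 𝓛 = ∀ (F B : Subset E) → Base Fin[ 𝓛 ] F → Base 𝓛 B → B ⊆ F →
                     Finite (F ∖ B)

  KNearlyFinitary : ℕ → Family E → Set₁
  KNearlyFinitary k 𝓛 = ∀ (F B : Subset E) → Base Fin[ 𝓛 ] F → Base 𝓛 B → B ⊆ F →
                         AtMost k (F ∖ B)

  Hat : Family E → Family E
  Hat 𝓛 S = Σ (Subset E) λ F → Σ (Subset E) λ B →
              Base Fin[ 𝓛 ] F × Base 𝓛 B × B ⊆ F × S ⊆ (F ∖ B)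

-- M̂ is a matroid, so by (I4) it has a base D; being M̂-independent, D lies in some F ∖ B and is
-- therefore finite because M is nearly finitary. The exchange axiom (I3) shows that no
-- M̂-independent set has more elements than the finite base D, and every F ∖ B is M̂-independent,
-- so k = |D| works.
module Submission where

open import Defs
open import Data.Nat using (ℕ; suc; _≤_; _+_; s≤s; z≤n)
open import Data.Nat.Properties using (+-suc; +-identityʳ; module ≤-Reasoning)
open import Data.Product using (Σ; _×_; _,_; proj₂)
open import Data.Sum using (inj₁; inj₂)
open import Data.Empty using (⊥; ⊥-elim)
open import Data.Unit using (⊤)
open import Data.List using (List; []; _∷_; length; _++_; filter; deduplicate)
open import Data.List.Properties using (length-++)
open import Data.List.Membership.Propositional using (_∈_; _∉_)
open import Data.List.Membership.Propositional.Properties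
  using (∈-∃++; ∈-++⁻; ∈-++⁺ˡ; ∈-++⁺ʳ; ∈-filter⁺; ∈-filter⁻; ∈-deduplicate⁺; ∈-deduplicate⁻)
open import Data.List.Relation.Unary.Any using (here; there)
open import Data.List.Relation.Unary.All.Properties using (All¬⇒¬Any; ¬Any⇒All¬)
open import Data.List.Relation.Unary.AllPairs using ([]; _∷_; head; tail)
open import Data.List.Relation.Unary.Unique.Propositional using (Unique)
open import Data.List.Relation.Unary.Unique.DecPropositional.Properties using (deduplicate-!)
open import Data.List.Relation.Binary.Disjoint.Propositional using (Disjoint)
open import Function using (_∘_)
open import Level using (Lift; lift; lower)
open import Relation.Nullary using (¬_; Dec; yes; no)
open import Relation.Binary.Definitions using (DecidableEquality)
open import Relation.Binary.PropositionalEquality using (_≡_; refl; sym; trans; cong; subst)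
open import Relation.Unary using (_⊆_; _∪_; ｛_｝)

module _ {E : Set} where

  ⟦_⟧ : List E → Subset E
  ⟦ xs ⟧ x = x ∈ xs

  Unique⇒∉ : ∀ {x : E} {xs} → Unique (x ∷ xs) → x ∉ xs
  Unique⇒∉ = All¬⇒¬Any ∘ head

  length-≤-of-Unique-⊆ : ∀ {xs ys} → Unique xs → ⟦ xs ⟧ ⊆ ⟦ ys ⟧ → length xs ≤ length ys
  length-≤-of-Unique-⊆ {[]} _ _ = z≤n
  length-≤-of-Unique-⊆ {x ∷ xs} !xs xs⊆ys with ∈-∃++ (xs⊆ys (here refl))
  ... | ys₁ , ys₂ , refl = begin
    suc (length xs)                  ≤⟨ s≤s (length-≤-of-Unique-⊆ (tail !xs) xs⊆ys₁ys₂) ⟩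
    suc (length (ys₁ ++ ys₂))        ≡⟨ cong suc (length-++ ys₁) ⟩
    suc (length ys₁ + length ys₂)    ≡⟨ sym (+-suc (length ys₁) (length ys₂)) ⟩
    length ys₁ + length (x ∷ ys₂)    ≡⟨ sym (length-++ ys₁) ⟩
    length (ys₁ ++ x ∷ ys₂)          ∎
    where
    open ≤-Reasoning
    xs⊆ys₁ys₂ : ⟦ xs ⟧ ⊆ ⟦ ys₁ ++ ys₂ ⟧
    xs⊆ys₁ys₂ y∈xs with ∈-++⁻ ys₁ (xs⊆ys (there y∈xs))
    ... | inj₁ y∈ys₁         = ∈-++⁺ˡ y∈ys₁
    ... | inj₂ (here refl)   = ⊥-elim (Unique⇒∉ !xs y∈xs)
    ... | inj₂ (there y∈ys₂) = ∈-++⁺ʳ ys₁ y∈ys₂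

module _ {E : Set} {𝓛 : Family E} (M : IsMatroid 𝓛) where
  open IsMatroid M

  base-exists : Σ (Subset E) (Base 𝓛)
  base-exists with I4 (λ _ → ⊥) (λ _ → ⊤) I1 (λ ())
  ... | D , (𝓛D , _ , _) , maximal =
    D , 𝓛D , λ B 𝓛B D⊆B → maximal B (𝓛B , (λ ()) , _) D⊆B

  ¬Maximal-of-extension : ∀ {A a} → 𝓛 (A ∪ ｛ a ｝) → ¬ A a → ¬ Maximal 𝓛 A
  ¬Maximal-of-extension {A} {a} 𝓛A+a a∉A (_ , maximal) =
    a∉A (maximal (A ∪ ｛ a ｝) 𝓛A+a inj₁ (inj₂ refl))

  -- The elements of outs are traded one at a time, by (I3) against the base D, for fresh
  -- elements of D, keeping ins ∪ outs independent and its size unchanged.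
  exchange-into-base : ∀ {D} → Base 𝓛 D → ∀ ins outs →
    Unique ins → Unique outs → Disjoint ins outs → ⟦ ins ⟧ ⊆ D → 𝓛 (⟦ ins ⟧ ∪ ⟦ outs ⟧) →
    Σ (List E) λ ys → Unique ys × ⟦ ys ⟧ ⊆ D × length ys ≡ length ins + length outs
  exchange-into-base _ ins [] !ins _ _ ins⊆D _ =
    ins , !ins , ins⊆D , sym (+-identityʳ (length ins))
  exchange-into-base {D} baseD ins (a ∷ outs) !ins !outs disjoint ins⊆D 𝓛ins+outs
    with I3 A D baseD 𝓛A (¬Maximal-of-extension 𝓛A+a a∉A)
    where
    A : Subset E
    A = ⟦ ins ⟧ ∪ ⟦ outs ⟧
    a∉A : ¬ A a
    a∉A (inj₁ a∈ins)  = disjoint (a∈ins , here refl)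
    a∉A (inj₂ a∈outs) = Unique⇒∉ !outs a∈outs
    𝓛A : 𝓛 A
    𝓛A = I2 _ _ 𝓛ins+outs λ { (inj₁ p) → inj₁ p ; (inj₂ q) → inj₂ (there q) }
    𝓛A+a : 𝓛 (A ∪ ｛ a ｝)
    𝓛A+a = I2 _ _ 𝓛ins+outs λ { (inj₁ (inj₁ p)) → inj₁ p
                                 ; (inj₁ (inj₂ q)) → inj₂ (there q)
                                 ; (inj₂ refl)     → inj₂ (here refl) }
  ... | b , b∈D , b∉A , 𝓛A+b
    with exchange-into-base baseD (b ∷ ins) outs
           (¬Any⇒All¬ _ (b∉A ∘ inj₁) ∷ !ins) (tail !outs) disjoint′ ins′⊆D 𝓛ins′+outs
    where
    disjoint′ : Disjoint (b ∷ ins) outs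
    disjoint′ (here refl , b∈outs)   = b∉A (inj₂ b∈outs)
    disjoint′ (there x∈ins , x∈outs) = disjoint (x∈ins , there x∈outs)
    ins′⊆D : ⟦ b ∷ ins ⟧ ⊆ D
    ins′⊆D (here refl)   = b∈D
    ins′⊆D (there x∈ins) = ins⊆D x∈ins
    𝓛ins′+outs : 𝓛 (⟦ b ∷ ins ⟧ ∪ ⟦ outs ⟧)
    𝓛ins′+outs = I2 _ _ 𝓛A+b λ { (inj₁ (here refl)) → inj₂ refl
                                ; (inj₁ (there p))   → inj₁ (inj₁ p)
                                ; (inj₂ q)           → inj₁ (inj₂ q) }
  ... | ys , !ys , ys⊆D , ∣ys∣ =
    ys , !ys , ys⊆D , trans ∣ys∣ (sym (+-suc (length ins) (length outs)))

  independent-length-≤-finite-base : ∀ {D ds xs} → Base 𝓛 D → D ⊆ ⟦ ds ⟧ →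
    Unique xs → 𝓛 ⟦ xs ⟧ → length xs ≤ length ds
  independent-length-≤-finite-base {ds = ds} {xs} baseD D⊆ds !xs 𝓛xs
    with exchange-into-base baseD [] xs [] !xs (λ ()) (λ ()) (I2 _ _ 𝓛xs λ { (inj₂ p) → p })
  ... | ys , !ys , ys⊆D , ∣ys∣≡∣xs∣ =
    subst (_≤ length ds) ∣ys∣≡∣xs∣ (length-≤-of-Unique-⊆ !ys (D⊆ds ∘ ys⊆D))

module _ (em : ExcludedMiddle) {E : Set} where

  decide : (P : Set) → Dec P
  decide P with em (Lift _ P)
  ... | inj₁ p  = yes (lower p)
  ... | inj₂ ¬p = no (¬p ∘ lift)

  _≟_ : DecidableEquality E
  x ≟ y = decide (x ≡ y)

  Unique-listing-of-Finite : ∀ {S : Subset E} → Finite S →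
    Σ (List E) λ ys → Unique ys × ⟦ ys ⟧ ⊆ S × S ⊆ ⟦ ys ⟧
  Unique-listing-of-Finite {S} (xs , S⊆xs) =
    deduplicate _≟_ (filter S? xs) ,
    deduplicate-! _≟_ (filter S? xs) ,
    (λ y∈ → proj₂ (∈-filter⁻ S? {xs = xs} (∈-deduplicate⁻ _≟_ (filter S? xs) y∈))) ,
    (λ Sx → ∈-deduplicate⁺ _≟_ (∈-filter⁺ S? (S⊆xs Sx) Sx))
    where
    S? : ∀ x → Dec (S x)
    S? x = decide (S x)

Finite-of-Hat : ∀ {E} {𝓛 : Family E} {S} → NearlyFinitary 𝓛 → Hat 𝓛 S → Finite S
Finite-of-Hat nf (F , B , baseF , baseB , B⊆F , S⊆F∖B) with nf F B baseF baseB B⊆F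
... | xs , F∖B⊆xs = xs , F∖B⊆xs ∘ S⊆F∖B

theorem3p4p1 : ExcludedMiddle → (E : Set) (𝓛 : Family E) →
    IsMatroid 𝓛 → NearlyFinitary 𝓛 → IsMatroid (Hat 𝓛) →
    Σ ℕ λ k → KNearlyFinitary k 𝓛
theorem3p4p1 em E 𝓛 _ nf hat with base-exists hat
... | D , baseD@(hatD , _) with Finite-of-Hat nf hatD
... | ds , D⊆ds = length ds , bound
  where
  bound : KNearlyFinitary (length ds) 𝓛
  bound F B baseF baseB B⊆F with Unique-listing-of-Finite em (nf F B baseF baseB B⊆F)
  ... | ys , !ys , ys⊆F∖B , F∖B⊆ys =
    ys , independent-length-≤-finite-base hat baseD D⊆ds !ys hatys , F∖B⊆ys
    where
    hatys : Hat 𝓛 ⟦ ys ⟧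
    hatys = F , B , baseF , baseB , B⊆F , ys⊆F∖B
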